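{- In the timed process algebra T-AWN (default version, in which all nodes are input enabled), let $N$ be a partial network expression and let $L$ be the set of addresses of the nodes of $N$. Then for every partition $L=H\mathbin{\dot\cup}K$ of $L$ into sets $H$ and $K$, and every $m\in\mathrm{MSG}$, we have $N\xrightarrow{H\neg K:\mathbf{arrive}(m)}$.
   Context: $N\xrightarrow{a}$ means that there exists $N'$ with $N\xrightarrow{a}N'$. Node expressions are $ip:P:R$, with address $ip\in\mathrm{IP}$, parallel process expression $P$ and range $R\subseteq\mathrm{IP}$. Partial network expressions are $M::=ip:P:R\mid M\|M$; the addresses of the nodes of $M$ are the $ip$'s of its node expressions. The relevant transition rules for arrive actions are: - (n-rcv) if $P\xrightarrow{\mathbf{receive}(m)}P'$, then $ip:P:R\xrightarrow{\{ip\}\neg\emptyset:\mathbf{arrive}(m)}ip:P':R$; - (n-dis) $ip:P:R\xrightarrow{\emptyset\neg\{ip\}:\mathbf{arrive}(m)}ip:P:R$ for every $m$; - (arr) if $M\xrightarrow{H\neg K:\mathbf{arrive}(m)}M'$ and $N\xrightarrow{H'\neg K':\mathbf{arrive}(m)}N'$, then $M\|N\xrightarrow{(H\cup H')\neg(K\cup K'):\mathbf{arrive}(m)}M'\|N'$. Standing assumption of the default version of T-AWN (input enabledness): for every node expression $ip:P:R$ and every $m\in\mathrm{MSG}$, $P\xrightarrow{\mathbf{receive}(m)}$. -}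

module Defs where

open import Data.Empty using (⊥)
open import Data.Sum using (_⊎_)
open import Data.Product using (_×_; ∃; ∃-syntax)
open import Relation.Binary.PropositionalEquality using (_≡_)

Subset : Set → Set₁
Subset IP = IP → Set

∅ : {IP : Set} → Subset IP
∅ _ = ⊥

｛_｝ : {IP : Set} → IP → Subset IP
｛ ip ｝ = λ x → x ≡ ip

_∪_ : {IP : Set} → Subset IP → Subset IP → Subset IP
(A ∪ B) x = A x ⊎ B x

_≐_ : {IP : Set} → Subset IP → Subset IP → Set
A ≐ B = ∀ x → (A x → B x) × (B x → A x)

module TAWN {IP MSG Proc : Set}
            (_─receive_⟶_ : Proc → MSG → Proc → Set) where

  data Net : Set₁ where
    node : IP → Proc → Subset IP → Net
    _∥_  : Net → Net → Net

  addr : Net → Subset IP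
  addr (node ip P R) x = x ≡ ip
  addr (M ∥ N) x = addr M x ⊎ addr N x

  data _─[_¬_∶arrive_]⟶_ : Net → Subset IP → Subset IP → MSG → Net → Set₁ where
    n-rcv : ∀ {ip P P' R m} → P ─receive m ⟶ P' →
            node ip P R ─[ ｛ ip ｝ ¬ ∅ ∶arrive m ]⟶ node ip P' R
    n-dis : ∀ {ip P R m} →
            node ip P R ─[ ∅ ¬ ｛ ip ｝ ∶arrive m ]⟶ node ip P R
    arr   : ∀ {M M' N N' H K H' K' m} →
            M ─[ H ¬ K ∶arrive m ]⟶ M' →
            N ─[ H' ¬ K' ∶arrive m ]⟶ N' →
            (M ∥ N) ─[ (H ∪ H') ¬ (K ∪ K') ∶arrive m ]⟶ (M' ∥ N')

  -- N --H¬K:arrive(m)-->  (some N' exists); labels are sets, so they are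
  -- compared extensionally.
  CanArrive : Net → Subset IP → Subset IP → MSG → Set₁
  CanArrive N H K m =
    ∃[ N' ] ∃[ H₀ ] ∃[ K₀ ] (N ─[ H₀ ¬ K₀ ∶arrive m ]⟶ N') × (H₀ ≐ H) × (K₀ ≐ K)

  IsPartition : Subset IP → Subset IP → Subset IP → Set
  IsPartition L H K = (L ≐ (H ∪ K)) × (∀ x → H x → K x → ⊥)

  InputEnabled : Set
  InputEnabled = ∀ (P : Proc) (m : MSG) → ∃[ P' ] (P ─receive m ⟶ P')

-- Generalise over arbitrary disjoint H and K covering the addresses, and show
-- that N can perform the arrive action labelled by their restrictions to the
-- addresses of N. By induction on N: a node with address in H receives m
-- (input enabledness), one with address in K discards it, and (arr) unions the
-- labels of the two components, which matches restriction distributing over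
-- the union of their addresses. When H ∪ K is exactly the address set, the
-- restrictions are H and K themselves.
module Submission where

open import Defs
open import Data.Empty using (⊥)
open import Data.Sum using ([_,_]; inj₁; inj₂) renaming (map to ⊎-map)
open import Data.Product using (_,_; proj₁; proj₂; swap)
open import Function using (_∘_; id)
open import Relation.Nullary using (¬_)
open import Relation.Unary using (_∩_; _⊆_)
open import Relation.Binary.PropositionalEquality using (refl; subst; sym)

module _ {IP : Set} where

  ≐-refl : {A : Subset IP} → A ≐ A
  ≐-refl _ = id , id

  ≐-sym : {A B : Subset IP} → A ≐ B → B ≐ A
  ≐-sym A≐B = swap ∘ A≐B

  ≐-trans : {A B C : Subset IP} → A ≐ B → B ≐ C → A ≐ C
  ≐-trans A≐B B≐C x = proj₁ (B≐C x) ∘ proj₁ (A≐B x) , proj₂ (A≐B x) ∘ proj₂ (B≐C x)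

  ∪-cong : {A A′ B B′ : Subset IP} → A ≐ A′ → B ≐ B′ → (A ∪ B) ≐ (A′ ∪ B′)
  ∪-cong A≐A′ B≐B′ x = ⊎-map (proj₁ (A≐A′ x)) (proj₁ (B≐B′ x))
                     , ⊎-map (proj₂ (A≐A′ x)) (proj₂ (B≐B′ x))

  ∩-distribˡ-∪ : (A B C : Subset IP) → (A ∩ (B ∪ C)) ≐ ((A ∩ B) ∪ (A ∩ C))
  ∩-distribˡ-∪ A B C x =
      (λ { (a , inj₁ b) → inj₁ (a , b) ; (a , inj₂ c) → inj₂ (a , c) })
    , [ (λ { (a , b) → a , inj₁ b }) , (λ { (a , c) → a , inj₂ c }) ]

  ⊆⇒∩≐ : {A B : Subset IP} → A ⊆ B → (A ∩ B) ≐ A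
  ⊆⇒∩≐ A⊆B x = proj₁ , λ a → a , A⊆B a

  ∈⇒｛｝≐∩｛｝ : {A : Subset IP} {ip : IP} → A ip → ｛ ip ｝ ≐ (A ∩ ｛ ip ｝)
  ∈⇒｛｝≐∩｛｝ {A} a x = (λ x≡ip → subst A (sym x≡ip) a , x≡ip) , proj₂

  ∉⇒∅≐∩｛｝ : {A : Subset IP} {ip : IP} → ¬ A ip → ∅ ≐ (A ∩ ｛ ip ｝)
  ∉⇒∅≐∩｛｝ {A} a∉ x = (λ ()) , λ { (a , x≡ip) → a∉ (subst A x≡ip a) }

module _ {IP MSG Proc : Set} (recv : Proc → MSG → Proc → Set) where
  open TAWN {IP} {MSG} {Proc} recv

  CanArrive-resp-≐ : ∀ {N H H′ K K′ m} → H ≐ H′ → K ≐ K′ →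
                     CanArrive N H K m → CanArrive N H′ K′ m
  CanArrive-resp-≐ H≐H′ K≐K′ (N′ , H₀ , K₀ , t , H₀≐H , K₀≐K) =
    N′ , H₀ , K₀ , t , ≐-trans H₀≐H H≐H′ , ≐-trans K₀≐K K≐K′

  CanArrive-∥ : ∀ {M N H H′ K K′ m} → CanArrive M H K m → CanArrive N H′ K′ m →
                CanArrive (M ∥ N) (H ∪ H′) (K ∪ K′) m
  CanArrive-∥ (M′ , _ , _ , tM , HM≐H , KM≐K) (N′ , _ , _ , tN , HN≐H′ , KN≐K′) =
    M′ ∥ N′ , _ , _ , arr tM tN , ∪-cong HM≐H HN≐H′ , ∪-cong KM≐K KN≐K′

  canArrive-restricted : InputEnabled → (N : Net) {H K : Subset IP} (m : MSG) →
                         (∀ x → H x → K x → ⊥) → addr N ⊆ (H ∪ K) →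
                         CanArrive N (H ∩ addr N) (K ∩ addr N) m
  canArrive-restricted enabled (node ip P R) m disjoint covers with covers refl
  ... | inj₁ h = let P′ , r = enabled P m in
    CanArrive-resp-≐ (∈⇒｛｝≐∩｛｝ h) (∉⇒∅≐∩｛｝ (disjoint ip h))
      (node ip P′ R , _ , _ , n-rcv r , ≐-refl , ≐-refl)
  ... | inj₂ k =
    CanArrive-resp-≐ (∉⇒∅≐∩｛｝ (λ h → disjoint ip h k)) (∈⇒｛｝≐∩｛｝ k)
      (node ip P R , _ , _ , n-dis , ≐-refl , ≐-refl)
  canArrive-restricted enabled (M ∥ N) {H} {K} m disjoint covers =
    CanArrive-resp-≐ (≐-sym (∩-distribˡ-∪ H (addr M) (addr N)))
                     (≐-sym (∩-distribˡ-∪ K (addr M) (addr N)))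
      (CanArrive-∥ (canArrive-restricted enabled M m disjoint (covers ∘ inj₁))
                   (canArrive-restricted enabled N m disjoint (covers ∘ inj₂)))

lemma2 : {IP MSG Proc : Set} (recv : Proc → MSG → Proc → Set) →
         TAWN.InputEnabled {IP} {MSG} {Proc} recv →
         (N : TAWN.Net {IP} {MSG} {Proc} recv) (H K : Subset IP) (m : MSG) →
         TAWN.IsPartition {IP} {MSG} {Proc} recv (TAWN.addr recv N) H K →
         TAWN.CanArrive recv N H K m
lemma2 recv enabled N H K m (addr≐H∪K , disjoint) =
  CanArrive-resp-≐ recv (⊆⇒∩≐ (proj₂ (addr≐H∪K _) ∘ inj₁))
                        (⊆⇒∩≐ (proj₂ (addr≐H∪K _) ∘ inj₂))
    (canArrive-restricted recv enabled N m disjoint (proj₁ (addr≐H∪K _)))
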